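{- Let $X$ be a finite non-empty set and $a,b,r\in 2^X$, with $r^c=X\setminus r$. If $\mathrm{Jac}(a,r)=\mathrm{Jac}(b,r)$ and $\mathrm{Jac}(a,r^c)=\mathrm{Jac}(b,r^c)$, then \[\bigl(|r^c|-|r|\bigr)\cdot\bigl(|b\cap r|-|a\cap r|\bigr)=|r^c|\cdot\bigl(|b|-|a|\bigr).\]
   Context: For a finite set $X$, $2^X$ is its power set. The Jaccard distance on $2^X$ is $\mathrm{Jac}(a,b)=|a\,\Delta\, b|/|a\cup b|$ for $a\neq b$ and $\mathrm{Jac}(a,a)=0$, where $\Delta$ is symmetric difference. -}

module Defs where

open import Data.Nat using (ℕ; zero; suc)
open import Data.Integer using (ℤ; +_)
open import Data.Rational using (ℚ; _/_; 0ℚ)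
open import Data.Fin.Subset using (Subset; _∪_; _─_; ∣_∣)
open import Data.Vec.Properties using (≡-dec)
open import Data.Bool.Properties renaming (_≟_ to _≟ᵇ_)
open import Relation.Nullary using (yes; no)

_Δ_ : ∀ {n} → Subset n → Subset n → Subset n
a Δ b = (a ─ b) ∪ (b ─ a)

-- |a Δ b| / |a ∪ b| as a rational, with denominator by cases
-- (the denominator is never 0 when a ≠ b; the zero branch is unreachable then)
private
  ratio : ℕ → ℕ → ℚ
  ratio m zero    = 0ℚ
  ratio m (suc k) = (+ m) / suc k

Jac : ∀ {n} → Subset n → Subset n → ℚ
Jac a b with ≡-dec _≟ᵇ_ a b
... | yes _ = 0ℚ
... | no  _ = ratio ∣ a Δ b ∣ ∣ a ∪ b ∣

{-# OPTIONS --safe #-}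
-- Since Jac(p, r) = 1 − |p ∩ r| / |p ∪ r| and |p ∪ r| = |p ∖ r| + |r|, equal distances of a and b
-- to r cross-multiply to |a ∩ r| (|b ∖ r| + |r|) = |b ∩ r| (|a ∖ r| + |r|); equal distances to ∁ r
-- give the same with ∩ r and ∖ r exchanged and |∁ r| for |r|. The claimed identity is a ring
-- consequence of these two equations: its two sides differ exactly by the sum of their defects.
module Submission where

open import Defs
open import Data.Nat using (ℕ; NonZero; zero; suc)
import Data.Nat as ℕ
import Data.Nat.Properties as ℕ
open import Data.Integer using (ℤ; +_; _-_; _*_; _+_; 0ℤ)
open import Data.Integer.Properties using (pos-+; pos-*; i≡j⇒i-j≡0; +-identityʳ)
open import Data.Integer.Tactic.RingSolver using (solve-∀)
open import Data.Fin.Subset using (Subset; ∁; _∩_; _∪_; ∣_∣; inside; outside)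
open import Data.Vec using ([]; _∷_)
open import Data.Vec.Properties using (≡-dec)
open import Data.Bool.Properties using (not-involutive) renaming (_≟_ to _≟ᵇ_)
open import Data.Rational using (ℚ; 0ℚ) renaming (_/_ to _/ℚ_)
open import Data.Rational.Properties using (0/n≡0; normalize-injective-≃)
open import Relation.Nullary using (yes; no)
open import Relation.Binary.PropositionalEquality

private
  variable
    n : ℕ

∁-involutive : (p : Subset n) → ∁ (∁ p) ≡ p
∁-involutive []      = refl
∁-involutive (x ∷ p) = cong₂ _∷_ (not-involutive x) (∁-involutive p)

∣pΔp∣≡0 : (p : Subset n) → ∣ p Δ p ∣ ≡ 0
∣pΔp∣≡0 []            = refl
∣pΔp∣≡0 (inside ∷ p)  = ∣pΔp∣≡0 p
∣pΔp∣≡0 (outside ∷ p) = ∣pΔp∣≡0 p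

∣pΔq∣+∣p∩q∣≡∣p∪q∣ : (p q : Subset n) → ∣ p Δ q ∣ ℕ.+ ∣ p ∩ q ∣ ≡ ∣ p ∪ q ∣
∣pΔq∣+∣p∩q∣≡∣p∪q∣ []            []            = refl
∣pΔq∣+∣p∩q∣≡∣p∪q∣ (inside ∷ p)  (inside ∷ q)  = trans (ℕ.+-suc _ _) (cong suc (∣pΔq∣+∣p∩q∣≡∣p∪q∣ p q))
∣pΔq∣+∣p∩q∣≡∣p∪q∣ (inside ∷ p)  (outside ∷ q) = cong suc (∣pΔq∣+∣p∩q∣≡∣p∪q∣ p q)
∣pΔq∣+∣p∩q∣≡∣p∪q∣ (outside ∷ p) (inside ∷ q)  = cong suc (∣pΔq∣+∣p∩q∣≡∣p∪q∣ p q)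
∣pΔq∣+∣p∩q∣≡∣p∪q∣ (outside ∷ p) (outside ∷ q) = ∣pΔq∣+∣p∩q∣≡∣p∪q∣ p q

∣p∩q∣+∣p∩∁q∣≡∣p∣ : (p q : Subset n) → ∣ p ∩ q ∣ ℕ.+ ∣ p ∩ ∁ q ∣ ≡ ∣ p ∣
∣p∩q∣+∣p∩∁q∣≡∣p∣ []            []            = refl
∣p∩q∣+∣p∩∁q∣≡∣p∣ (inside ∷ p)  (inside ∷ q)  = cong suc (∣p∩q∣+∣p∩∁q∣≡∣p∣ p q)
∣p∩q∣+∣p∩∁q∣≡∣p∣ (inside ∷ p)  (outside ∷ q) = trans (ℕ.+-suc _ _) (cong suc (∣p∩q∣+∣p∩∁q∣≡∣p∣ p q))
∣p∩q∣+∣p∩∁q∣≡∣p∣ (outside ∷ p) (inside ∷ q)  = ∣p∩q∣+∣p∩∁q∣≡∣p∣ p q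
∣p∩q∣+∣p∩∁q∣≡∣p∣ (outside ∷ p) (outside ∷ q) = ∣p∩q∣+∣p∩∁q∣≡∣p∣ p q

∣p∩∁q∣+∣q∣≡∣p∪q∣ : (p q : Subset n) → ∣ p ∩ ∁ q ∣ ℕ.+ ∣ q ∣ ≡ ∣ p ∪ q ∣
∣p∩∁q∣+∣q∣≡∣p∪q∣ []            []            = refl
∣p∩∁q∣+∣q∣≡∣p∪q∣ (inside ∷ p)  (inside ∷ q)  = trans (ℕ.+-suc _ _) (cong suc (∣p∩∁q∣+∣q∣≡∣p∪q∣ p q))
∣p∩∁q∣+∣q∣≡∣p∪q∣ (inside ∷ p)  (outside ∷ q) = cong suc (∣p∩∁q∣+∣q∣≡∣p∪q∣ p q)
∣p∩∁q∣+∣q∣≡∣p∪q∣ (outside ∷ p) (inside ∷ q)  = trans (ℕ.+-suc _ _) (cong suc (∣p∩∁q∣+∣q∣≡∣p∪q∣ p q))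
∣p∩∁q∣+∣q∣≡∣p∪q∣ (outside ∷ p) (outside ∷ q) = ∣p∩∁q∣+∣q∣≡∣p∪q∣ p q

ratio : ℕ → ℕ → ℚ
ratio m zero    = 0ℚ
ratio m (suc k) = (+ m) /ℚ suc k

ratio-zeroˡ : ∀ k → ratio 0 k ≡ 0ℚ
ratio-zeroˡ zero    = refl
ratio-zeroˡ (suc k) = 0/n≡0 (suc k)

Jac≡ratio : (p q : Subset n) → Jac p q ≡ ratio ∣ p Δ q ∣ ∣ p ∪ q ∣
Jac≡ratio p q with ≡-dec _≟ᵇ_ p q
... | yes refl = sym (trans (cong (λ d → ratio d ∣ p ∪ p ∣) (∣pΔp∣≡0 p)) (ratio-zeroˡ ∣ p ∪ p ∣))
... | no _ with ∣ p ∪ q ∣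
...   | zero  = refl
...   | suc k = refl

complement-cross : ∀ {d x s d′ x′ s′} → d ℕ.+ x ≡ s → d′ ℕ.+ x′ ≡ s′ →
                   d ℕ.* s′ ≡ d′ ℕ.* s → x ℕ.* s′ ≡ x′ ℕ.* s
complement-cross {d} {x} {s} {d′} {x′} {s′} refl refl ds′≡d′s =
  ℕ.+-cancelʳ-≡ (d ℕ.* s′) (x ℕ.* s′) (x′ ℕ.* s) (begin
    x ℕ.* s′ ℕ.+ d ℕ.* s′    ≡⟨ ℕ.*-distribʳ-+ s′ x d ⟨
    (x ℕ.+ d) ℕ.* s′         ≡⟨ cong (ℕ._* s′) (ℕ.+-comm x d) ⟩
    s ℕ.* s′                 ≡⟨ ℕ.*-comm s s′ ⟩
    s′ ℕ.* s                 ≡⟨ cong (ℕ._* s) (ℕ.+-comm d′ x′) ⟩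
    (x′ ℕ.+ d′) ℕ.* s        ≡⟨ ℕ.*-distribʳ-+ s x′ d′ ⟩
    x′ ℕ.* s ℕ.+ d′ ℕ.* s    ≡⟨ cong (x′ ℕ.* s ℕ.+_) ds′≡d′s ⟨
    x′ ℕ.* s ℕ.+ d ℕ.* s′    ∎)
  where open ≡-Reasoning

-- An empty denominator forces an empty numerator, so the junk value 0 is harmless.
ratio-complement-cross : ∀ {d x s d′ x′ s′} → d ℕ.+ x ≡ s → d′ ℕ.+ x′ ≡ s′ →
                         ratio d s ≡ ratio d′ s′ → x ℕ.* s′ ≡ x′ ℕ.* s
ratio-complement-cross {d} {s = zero} {x′ = x′} e _ _
  rewrite ℕ.m+n≡0⇒n≡0 d e = sym (ℕ.*-zeroʳ x′)
ratio-complement-cross {x = x} {s = suc _} {d′} {s′ = zero} _ e′ _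
  rewrite ℕ.m+n≡0⇒n≡0 d′ e′ = ℕ.*-zeroʳ x
ratio-complement-cross {d} {x} {suc s} {d′} {x′} {suc s′} e e′ eq =
  complement-cross {x = x} {x′ = x′} e e′ (normalize-injective-≃ d d′ (suc s) (suc s′) eq)

Jac-cross-multiply : (p q r : Subset n) → Jac p r ≡ Jac q r →
  ∣ p ∩ r ∣ ℕ.* (∣ q ∩ ∁ r ∣ ℕ.+ ∣ r ∣) ≡ ∣ q ∩ r ∣ ℕ.* (∣ p ∩ ∁ r ∣ ℕ.+ ∣ r ∣)
Jac-cross-multiply p q r eq
  rewrite ∣p∩∁q∣+∣q∣≡∣p∪q∣ p r | ∣p∩∁q∣+∣q∣≡∣p∪q∣ q r =
  ratio-complement-cross (∣pΔq∣+∣p∩q∣≡∣p∪q∣ p r) (∣pΔq∣+∣p∩q∣≡∣p∪q∣ q r)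
    (trans (sym (Jac≡ratio p r)) (trans eq (Jac≡ratio q r)))

Jac-∁-cross-multiply : (p q r : Subset n) → Jac p (∁ r) ≡ Jac q (∁ r) →
  ∣ p ∩ ∁ r ∣ ℕ.* (∣ q ∩ r ∣ ℕ.+ ∣ ∁ r ∣) ≡ ∣ q ∩ ∁ r ∣ ℕ.* (∣ p ∩ r ∣ ℕ.+ ∣ ∁ r ∣)
Jac-∁-cross-multiply p q r eq =
  subst (λ r′ → ∣ p ∩ ∁ r ∣ ℕ.* (∣ q ∩ r′ ∣ ℕ.+ ∣ ∁ r ∣) ≡ ∣ q ∩ ∁ r ∣ ℕ.* (∣ p ∩ r′ ∣ ℕ.+ ∣ ∁ r ∣))
    (∁-involutive r) (Jac-cross-multiply p q (∁ r) eq)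

pos-*-+ : ∀ x y z → + (x ℕ.* (y ℕ.+ z)) ≡ + x * (+ y + + z)
pos-*-+ x y z = trans (pos-* x (y ℕ.+ z)) (cong (+ x *_) (pos-+ y z))

pos-cross : ∀ x y z x′ y′ z′ → x ℕ.* (y ℕ.+ z) ≡ x′ ℕ.* (y′ ℕ.+ z′) →
            + x * (+ y + + z) ≡ + x′ * (+ y′ + + z′)
pos-cross x y z x′ y′ z′ eq =
  trans (sym (pos-*-+ x y z)) (trans (cong +_ eq) (pos-*-+ x′ y′ z′))

cross-identity : ∀ (x y x′ y′ R C : ℤ) →
  x * (y′ + R) ≡ x′ * (y + R) → y * (x′ + C) ≡ y′ * (x + C) →
  (C - R) * (x′ - x) ≡ C * ((x′ + y′) - (x + y))
cross-identity x y x′ y′ R C e₁ e₂ = begin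
  (C - R) * (x′ - x)
    ≡⟨ expand x y x′ y′ R C ⟩
  C * ((x′ + y′) - (x + y)) + (x * (y′ + R) - x′ * (y + R)) + (y * (x′ + C) - y′ * (x + C))
    ≡⟨ cong₂ (λ d₁ d₂ → C * ((x′ + y′) - (x + y)) + d₁ + d₂) (i≡j⇒i-j≡0 e₁) (i≡j⇒i-j≡0 e₂) ⟩
  C * ((x′ + y′) - (x + y)) + 0ℤ + 0ℤ
    ≡⟨ trans (+-identityʳ _) (+-identityʳ _) ⟩
  C * ((x′ + y′) - (x + y)) ∎
  where
  open ≡-Reasoning
  expand : ∀ (x y x′ y′ R C : ℤ) → (C - R) * (x′ - x) ≡
    C * ((x′ + y′) - (x + y)) + (x * (y′ + R) - x′ * (y + R)) + (y * (x′ + C) - y′ * (x + C))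
  expand = solve-∀

cross-identity-pos : ∀ (x y x′ y′ R C : ℕ) →
  x ℕ.* (y′ ℕ.+ R) ≡ x′ ℕ.* (y ℕ.+ R) → y ℕ.* (x′ ℕ.+ C) ≡ y′ ℕ.* (x ℕ.+ C) →
  (+ C - + R) * (+ x′ - + x) ≡ + C * ((+ x′ + + y′) - (+ x + + y))
cross-identity-pos x y x′ y′ R C e₁ e₂ =
  cross-identity (+ x) (+ y) (+ x′) (+ y′) (+ R) (+ C)
    (pos-cross x y′ R x′ y R e₁) (pos-cross y x′ C y′ x C e₂)

pos-∣p∣ : (p q : Subset n) → + ∣ p ∣ ≡ + ∣ p ∩ q ∣ + + ∣ p ∩ ∁ q ∣
pos-∣p∣ p q = trans (cong +_ (sym (∣p∩q∣+∣p∩∁q∣≡∣p∣ p q))) (pos-+ ∣ p ∩ q ∣ ∣ p ∩ ∁ q ∣)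

corollary3 : (n : ℕ) → .{{_ : NonZero n}} → (a b r : Subset n) →
    Jac a r ≡ Jac b r → Jac a (∁ r) ≡ Jac b (∁ r) →
    ((+ ∣ ∁ r ∣) - (+ ∣ r ∣)) * ((+ ∣ b ∩ r ∣) - (+ ∣ a ∩ r ∣))
      ≡ (+ ∣ ∁ r ∣) * ((+ ∣ b ∣) - (+ ∣ a ∣))
corollary3 n a b r Jac-r Jac-∁r = begin
  (+ ∣ ∁ r ∣ - + ∣ r ∣) * (+ ∣ b ∩ r ∣ - + ∣ a ∩ r ∣)
    ≡⟨ cross-identity-pos (∣ a ∩ r ∣) (∣ a ∩ ∁ r ∣) (∣ b ∩ r ∣) (∣ b ∩ ∁ r ∣) (∣ r ∣) (∣ ∁ r ∣)
         (Jac-cross-multiply a b r Jac-r) (Jac-∁-cross-multiply a b r Jac-∁r) ⟩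
  + ∣ ∁ r ∣ * ((+ ∣ b ∩ r ∣ + + ∣ b ∩ ∁ r ∣) - (+ ∣ a ∩ r ∣ + + ∣ a ∩ ∁ r ∣))
    ≡⟨ cong₂ (λ u v → + ∣ ∁ r ∣ * (u - v)) (pos-∣p∣ b r) (pos-∣p∣ a r) ⟨
  + ∣ ∁ r ∣ * (+ ∣ b ∣ - + ∣ a ∣) ∎
  where open ≡-Reasoning
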